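{- (i) Every finite $\mathbf{HpsUL}^\ast$-chain is an $\mathbf{HpsUL}^\ast_\omega$-chain. (ii) Every finite $\mathbf{HpsUL}^\ast$-algebra is an $\mathbf{HpsUL}^\ast_\omega$-algebra.
   Context: An $\mathbf{HpsUL}$-algebra is an algebra $\mathcal{A}=\langle A,\wedge,\vee,\cdot,\backslash,/,e,f,\bot,\top\rangle$ such that: $\langle A,\wedge,\vee,\bot,\top\rangle$ is a bounded lattice; $\langle A,\cdot,e\rangle$ is a monoid; $xy\le z$ iff $x\le z/y$ iff $y\le x\backslash z$; and $\lambda_u((x\vee y)\backslash x)\vee\rho_v((x\vee y)\backslash y)=e$ for all $x,y,u,v$, where $\lambda_a(b)=(a\backslash(ba))\wedge e$, $\rho_a(b)=((ab)/a)\wedge e$. An $\mathbf{HpsUL}^\ast$-algebra is an $\mathbf{HpsUL}$-algebra satisfying: $xy\le e$ implies $yx\le e$. An $\mathbf{HpsUL}^\ast_\omega$-algebra is an $\mathbf{HpsUL}^\ast$-algebra satisfying $x\backslash e=x^2\backslash e$ for all $x$. A chain is one whose lattice order is linear. -}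

module Defs where

open import Level using (Level; suc; _⊔_)
open import Data.Nat using (ℕ)
open import Data.Fin using (Fin)
open import Data.Product using (Σ; _×_; _,_)
open import Data.Sum using (_⊎_)
open import Relation.Binary.PropositionalEquality using (_≡_)
open import Function.Bundles using (_↔_)

record HpsUL (a : Level) : Set (suc a) where
  infixr 7 _∧_
  infixr 6 _∨_
  infixl 8 _·_
  infixr 9 _＼_
  infixl 9 _／_
  infix 4 _≤_
  field
    A : Set a
    _∧_ _∨_ _·_ _＼_ _／_ : A → A → A
    e f bot top : A
    ∧-comm  : ∀ x y → x ∧ y ≡ y ∧ x
    ∨-comm  : ∀ x y → x ∨ y ≡ y ∨ x
    ∧-assoc : ∀ x y z → (x ∧ y) ∧ z ≡ x ∧ (y ∧ z)
    ∨-assoc : ∀ x y z → (x ∨ y) ∨ z ≡ x ∨ (y ∨ z)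
    ∧-absorb : ∀ x y → x ∧ (x ∨ y) ≡ x
    ∨-absorb : ∀ x y → x ∨ (x ∧ y) ≡ x
    bot-least : ∀ x → bot ∧ x ≡ bot
    top-greatest : ∀ x → x ∧ top ≡ x
    ·-assoc : ∀ x y z → (x · y) · z ≡ x · (y · z)
    ·-identityˡ : ∀ x → e · x ≡ x
    ·-identityʳ : ∀ x → x · e ≡ x

  _≤_ : A → A → Set a
  x ≤ y = x ∧ y ≡ x

  field
    res-／ : ∀ x y z → (x · y ≤ z → x ≤ z ／ y) × (x ≤ z ／ y → x · y ≤ z)
    res-＼ : ∀ x y z → (x · y ≤ z → y ≤ x ＼ z) × (y ≤ x ＼ z → x · y ≤ z)

  λ[_] : A → A → A
  λ[ a ] b = (a ＼ (b · a)) ∧ e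
  ρ[_] : A → A → A
  ρ[ a ] b = ((a · b) ／ a) ∧ e

  field
    hps : ∀ x y u v →
      λ[ u ] ((x ∨ y) ＼ x) ∨ ρ[ v ] ((x ∨ y) ＼ y) ≡ e

open HpsUL public

IsStar : ∀ {a} → HpsUL a → Set a
IsStar 𝒜 = ∀ x y → _≤_ 𝒜 (_·_ 𝒜 x y) (e 𝒜) → _≤_ 𝒜 (_·_ 𝒜 y x) (e 𝒜)

IsOmega : ∀ {a} → HpsUL a → Set a
IsOmega 𝒜 = ∀ x → _＼_ 𝒜 x (e 𝒜) ≡ _＼_ 𝒜 (_·_ 𝒜 x x) (e 𝒜)

IsChain : ∀ {a} → HpsUL a → Set a
IsChain 𝒜 = ∀ x y → _≤_ 𝒜 x y ⊎ _≤_ 𝒜 y x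

IsFinite : ∀ {a} → HpsUL a → Set a
IsFinite 𝒜 = Σ ℕ (λ n → A 𝒜 ↔ Fin n)

-- Whenever x has an idempotent power u = x ^ n (n ≥ 1), the elements z with
-- x z ≤ e are exactly those with u z ≤ e. From x z ≤ e one gets u z ^ n ≤ e,
-- and the star condition lets each factor z be traded for a factor of the
-- conjugate t = ρ_u((e ∨ u z) \ u z) across u, giving u z t ^ (n - 1) ≤ e;
-- the HpsUL identity gives u z ≤ u z t ^ j ∨ e, so u z ≤ e. Conversely u z ≤ e
-- gives u z ^ n ≤ e by idempotence and star, while the HpsUL identity gives
-- x z ≤ x ^ n z ^ n ∨ e. In a finite algebra every x has an idempotent power,
-- which x · x shares, so x \ e and (x · x) \ e are residuals of the same set.
module Submission where

open import Level using (Level)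
open import Data.Nat using (ℕ; zero; suc; _+_; _*_; _<_)
open import Data.Nat.Properties using (+-comm; +-suc; n<1+n; m≤n⇒∃[o]m+o≡n)
open import Data.Nat.Tactic.RingSolver using (solve-∀)
open import Data.Fin using (Fin; toℕ)
open import Data.Fin.Properties using (pigeonhole)
open import Data.Product using (_×_; _,_; proj₁; proj₂; ∃-syntax)
open import Function.Base using (_∘_)
open import Function.Bundles using (_↔_; _⇔_; mk⇔; Equivalence; Inverse; Injection)
open import Function.Properties.Inverse using (↔⇒↣)
open import Algebra.Bundles using (Monoid)
open import Relation.Binary.Bundles using (Poset)
open import Relation.Binary.Structures using (IsPartialOrder)
open import Relation.Binary.PropositionalEquality as ≡ using (_≡_; refl)

open import Defs using (HpsUL; IsFinite; IsStar; IsOmega; IsChain)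

module MonoidPowers {c ℓ} (M : Monoid c ℓ) where
  open Monoid M
  open import Algebra.Definitions _≈_ using (_IdempotentOn_)
  open import Algebra.Properties.Monoid.Mult M using (×-homo-+; ×-homo-1)
    renaming (_×_ to _times_)
  open import Relation.Binary.Reasoning.Setoid setoid

  infixr 10 _^_
  _^_ : Carrier → ℕ → Carrier
  x ^ n = n times x

  ^-+ : ∀ x m n → x ^ (m + n) ≈ x ^ m ∙ x ^ n
  ^-+ = ×-homo-+

  ^-comm : ∀ x m n → x ^ m ∙ x ^ n ≈ x ^ n ∙ x ^ m
  ^-comm x m n = begin
    x ^ m ∙ x ^ n  ≈⟨ ^-+ x m n ⟨
    x ^ (m + n)    ≡⟨ ≡.cong (x ^_) (+-comm m n) ⟩
    x ^ (n + m)    ≈⟨ ^-+ x n m ⟩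
    x ^ n ∙ x ^ m  ∎

  ^-sucʳ : ∀ x n → x ^ suc n ≈ x ^ n ∙ x
  ^-sucʳ x n = begin
    x ∙ x ^ n      ≈⟨ ∙-congʳ (×-homo-1 x) ⟨
    x ^ 1 ∙ x ^ n  ≈⟨ ^-comm x 1 n ⟩
    x ^ n ∙ x ^ 1  ≈⟨ ∙-congˡ (×-homo-1 x) ⟩
    x ^ n ∙ x      ∎

  ^-square : ∀ x n → (x ∙ x) ^ n ≈ x ^ n ∙ x ^ n
  ^-square x zero = sym (identityˡ ε)
  ^-square x (suc n) = begin
    (x ∙ x) ∙ (x ∙ x) ^ n      ≈⟨ ∙-congˡ (^-square x n) ⟩
    (x ∙ x) ∙ (x ^ n ∙ x ^ n)  ≈⟨ assoc x x _ ⟩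
    x ∙ (x ∙ (x ^ n ∙ x ^ n))  ≈⟨ ∙-congˡ (assoc x (x ^ n) (x ^ n)) ⟨
    x ∙ (x ^ suc n ∙ x ^ n)    ≈⟨ ∙-congˡ (∙-congʳ (^-sucʳ x n)) ⟩
    x ∙ ((x ^ n ∙ x) ∙ x ^ n)  ≈⟨ ∙-congˡ (assoc (x ^ n) x (x ^ n)) ⟩
    x ∙ (x ^ n ∙ x ^ suc n)    ≈⟨ assoc x (x ^ n) _ ⟨
    x ^ suc n ∙ x ^ suc n      ∎

  module _ (x : Carrier) where

    ^-absorbs-multiples : ∀ {a p} → x ^ a ∙ x ^ p ≈ x ^ a →
                          ∀ q → x ^ a ∙ x ^ (q * p) ≈ x ^ a
    ^-absorbs-multiples {a} _ zero = identityʳ (x ^ a)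
    ^-absorbs-multiples {a} {p} absorbs (suc q) = begin
      x ^ a ∙ x ^ (p + q * p)        ≈⟨ ∙-congˡ (^-+ x p (q * p)) ⟩
      x ^ a ∙ (x ^ p ∙ x ^ (q * p))  ≈⟨ assoc _ _ _ ⟨
      (x ^ a ∙ x ^ p) ∙ x ^ (q * p)  ≈⟨ ∙-congʳ absorbs ⟩
      x ^ a ∙ x ^ (q * p)            ≈⟨ ^-absorbs-multiples {a} absorbs q ⟩
      x ^ a                          ∎

    -- With period p = b - a, the power x ^ ((1 + a) * p) is idempotent:
    -- it is x ^ a times a power of x, and x ^ a absorbs every multiple of p.
    ^-periodic⇒idempotent-power : ∀ {a b} → a < b → x ^ a ≈ x ^ b →
                                  ∃[ m ] _∙_ IdempotentOn (x ^ suc m)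
    ^-periodic⇒idempotent-power {a} a<b recurs
      with k , refl ← m≤n⇒∃[o]m+o≡n a<b = k + a * suc k , idempotent
      where
        r = suc k + a * k
        u = x ^ (suc a * suc k)

        absorbs : x ^ a ∙ x ^ suc k ≈ x ^ a
        absorbs = begin
          x ^ a ∙ x ^ suc k  ≈⟨ ^-+ x a (suc k) ⟨
          x ^ (a + suc k)    ≡⟨ ≡.cong (x ^_) (+-suc a k) ⟩
          x ^ suc (a + k)    ≈⟨ recurs ⟨
          x ^ a              ∎

        exponent : ∀ a k → suc a * suc k ≡ a + (suc k + a * k)
        exponent = solve-∀

        u-split : u ≈ x ^ a ∙ x ^ r
        u-split = trans (reflexive (≡.cong (x ^_) (exponent a k))) (^-+ x a r)

        idempotent : u ∙ u ≈ u
        idempotent = begin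
          u ∙ u                  ≈⟨ ∙-congʳ u-split ⟩
          (x ^ a ∙ x ^ r) ∙ u    ≈⟨ ∙-congʳ (^-comm x a r) ⟩
          (x ^ r ∙ x ^ a) ∙ u    ≈⟨ assoc _ _ _ ⟩
          x ^ r ∙ (x ^ a ∙ u)    ≈⟨ ∙-congˡ (^-absorbs-multiples {a} {suc k} absorbs (suc a)) ⟩
          x ^ r ∙ x ^ a          ≈⟨ ^-comm x r a ⟩
          x ^ a ∙ x ^ r          ≈⟨ u-split ⟨
          u                      ∎

  finite⇒idempotent-power : ∀ {n} → Carrier ↔ Fin n →
                            ∀ x → ∃[ m ] _∙_ IdempotentOn (x ^ suc m)
  finite⇒idempotent-power {n} M↔Fin x
    with i , j , i<j , collide ← pigeonhole (n<1+n n) (λ k → Inverse.to M↔Fin (x ^ toℕ k))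
    = ^-periodic⇒idempotent-power x i<j
        (reflexive (Injection.injective (↔⇒↣ M↔Fin) collide))

module HpsULProperties {a} (𝒜 : HpsUL a) where
  open HpsUL 𝒜
  open ≡ using (sym; trans; cong; cong₂; subst)
  open import Algebra.Definitions (_≡_ {A = A}) using (_IdempotentOn_)

  ·-monoid : Monoid a a
  ·-monoid = record
    { Carrier = A
    ; _≈_ = _≡_
    ; _∙_ = _·_
    ; ε = e
    ; isMonoid = record
      { isSemigroup = record
        { isMagma = record { isEquivalence = ≡.isEquivalence ; ∙-cong = cong₂ _·_ }
        ; assoc = ·-assoc
        }
      ; identity = ·-identityˡ , ·-identityʳ
      }
    }

  open MonoidPowers ·-monoid
    using (_^_; ^-sucʳ; ^-square; finite⇒idempotent-power)

  ∧-idem : ∀ x → x ∧ x ≡ x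
  ∧-idem x = trans (cong (x ∧_) (sym (∨-absorb x x))) (∧-absorb x (x ∧ x))

  ≤-refl : ∀ {x} → x ≤ x
  ≤-refl {x} = ∧-idem x

  ≤-reflexive : ∀ {x y} → x ≡ y → x ≤ y
  ≤-reflexive refl = ≤-refl

  ≤-trans : ∀ {x y z} → x ≤ y → y ≤ z → x ≤ z
  ≤-trans {x} {y} {z} x≤y y≤z =
    trans (cong (_∧ z) (sym x≤y)) (trans (∧-assoc x y z) (trans (cong (x ∧_) y≤z) x≤y))

  ≤-antisym : ∀ {x y} → x ≤ y → y ≤ x → x ≡ y
  ≤-antisym {x} {y} x≤y y≤x = trans (sym x≤y) (trans (∧-comm x y) y≤x)

  ≤-isPartialOrder : IsPartialOrder _≡_ _≤_
  ≤-isPartialOrder = record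
    { isPreorder = record
      { isEquivalence = ≡.isEquivalence ; reflexive = ≤-reflexive ; trans = ≤-trans }
    ; antisym = ≤-antisym
    }

  ≤-poset : Poset a a a
  ≤-poset = record { isPartialOrder = ≤-isPartialOrder }

  open import Relation.Binary.Reasoning.PartialOrder ≤-poset

  x≤x∨y : ∀ {x y} → x ≤ x ∨ y
  x≤x∨y {x} {y} = ∧-absorb x y

  y≤x∨y : ∀ {x y} → y ≤ x ∨ y
  y≤x∨y {x} {y} = subst (y ≤_) (∨-comm y x) x≤x∨y

  x∧y≤y : ∀ {x y} → x ∧ y ≤ y
  x∧y≤y {x} {y} = trans (∧-assoc x y y) (cong (x ∧_) (∧-idem y))

  x∧y≤x : ∀ {x y} → x ∧ y ≤ x
  x∧y≤x {x} {y} = subst (_≤ x) (∧-comm y x) x∧y≤y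

  ∨-least : ∀ {x y z} → x ≤ z → y ≤ z → x ∨ y ≤ z
  ∨-least {x} {y} {z} x≤z y≤z = trans (cong ((x ∨ y) ∧_) (sym x∨y∨z≡z)) (∧-absorb (x ∨ y) z)
    where
      join-of-≤ : ∀ {p q} → p ≤ q → p ∨ q ≡ q
      join-of-≤ {p} {q} p≤q = trans (cong (_∨ q) (sym p≤q))
        (trans (∨-comm (p ∧ q) q) (trans (cong (q ∨_) (∧-comm p q)) (∨-absorb q p)))
      x∨y∨z≡z : (x ∨ y) ∨ z ≡ z
      x∨y∨z≡z = trans (∨-assoc x y z) (trans (cong (x ∨_) (join-of-≤ y≤z)) (join-of-≤ x≤z))

  ∨-monoˡ-≤ : ∀ {x y z} → x ≤ y → x ∨ z ≤ y ∨ z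
  ∨-monoˡ-≤ x≤y = ∨-least (≤-trans x≤y x≤x∨y) y≤x∨y

  ·-monoˡ-≤ : ∀ {x y z} → x ≤ y → x · z ≤ y · z
  ·-monoˡ-≤ {x} {y} {z} x≤y =
    proj₂ (res-／ x z (y · z)) (≤-trans x≤y (proj₁ (res-／ y z (y · z)) ≤-refl))

  ·-monoʳ-≤ : ∀ {x y z} → x ≤ y → z · x ≤ z · y
  ·-monoʳ-≤ {x} {y} {z} x≤y =
    proj₂ (res-＼ z x (z · y)) (≤-trans x≤y (proj₁ (res-＼ z y (z · y)) ≤-refl))

  ·-mono-≤ : ∀ {x y z w} → x ≤ y → z ≤ w → x · z ≤ y · w
  ·-mono-≤ x≤y z≤w = ≤-trans (·-monoˡ-≤ x≤y) (·-monoʳ-≤ z≤w)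

  ·-distribʳ-∨ : ∀ {x y z} → (x ∨ y) · z ≤ x · z ∨ y · z
  ·-distribʳ-∨ {x} {y} {z} = proj₂ (res-／ (x ∨ y) z _)
    (∨-least (proj₁ (res-／ x z _) x≤x∨y) (proj₁ (res-／ y z _) y≤x∨y))

  ·-distribˡ-∨ : ∀ {x y z} → z · (x ∨ y) ≤ z · x ∨ z · y
  ·-distribˡ-∨ {x} {y} {z} = proj₂ (res-＼ z (x ∨ y) _)
    (∨-least (proj₁ (res-＼ z x _) x≤x∨y) (proj₁ (res-＼ z y _) y≤x∨y))

  x·x＼y≤y : ∀ {x y} → x · x ＼ y ≤ y
  x·x＼y≤y {x} {y} = proj₂ (res-＼ x (x ＼ y) y) ≤-refl

  ＼-≤ : ∀ {x y} → e ≤ x → x ＼ y ≤ y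
  ＼-≤ {x} {y} e≤x = begin
    x ＼ y      ≡⟨ ·-identityˡ _ ⟨
    e · x ＼ y  ≤⟨ ·-monoˡ-≤ e≤x ⟩
    x · x ＼ y  ≤⟨ x·x＼y≤y ⟩
    y           ∎

  ＼-≤-＼ : ∀ {x y w} → (∀ z → x · z ≤ w → y · z ≤ w) → x ＼ w ≤ y ＼ w
  ＼-≤-＼ {x} {y} {w} x·z≤w⇒y·z≤w =
    proj₁ (res-＼ y (x ＼ w) w) (x·z≤w⇒y·z≤w (x ＼ w) x·x＼y≤y)

  λ≤e : ∀ {x y} → λ[ x ] y ≤ e
  λ≤e = x∧y≤y

  ρ≤e : ∀ {x y} → ρ[ x ] y ≤ e
  ρ≤e = x∧y≤y

  x·λ[x]y≤y·x : ∀ {x y} → x · λ[ x ] y ≤ y · x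
  x·λ[x]y≤y·x {x} {y} = proj₂ (res-＼ x (λ[ x ] y) (y · x)) x∧y≤x

  ρ[x]y·x≤x·y : ∀ {x y} → ρ[ x ] y · x ≤ x · y
  ρ[x]y·x≤x·y {x} {y} = proj₂ (res-／ (ρ[ x ] y) x (x · y)) x∧y≤x

  λ[e]y≤y : ∀ {y} → λ[ e ] y ≤ y
  λ[e]y≤y {y} = begin
    λ[ e ] y      ≡⟨ ·-identityˡ _ ⟨
    e · λ[ e ] y  ≤⟨ x·λ[x]y≤y·x ⟩
    y · e         ≡⟨ ·-identityʳ y ⟩
    y             ∎

  ρ[e]y≤y : ∀ {y} → ρ[ e ] y ≤ y
  ρ[e]y≤y {y} = begin
    ρ[ e ] y      ≡⟨ ·-identityʳ _ ⟨
    ρ[ e ] y · e  ≤⟨ ρ[x]y·x≤x·y ⟩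
    e · y         ≡⟨ ·-identityˡ y ⟩
    y             ∎

  ≤·∨e-split : ∀ {c β γ} → γ ∨ β ≡ e → c · β ≤ e → c ≤ c · γ ∨ e
  ≤·∨e-split {c} {β} {γ} split c·β≤e = begin
    c              ≡⟨ ·-identityʳ c ⟨
    c · e          ≡⟨ cong (c ·_) split ⟨
    c · (γ ∨ β)    ≤⟨ ·-distribˡ-∨ ⟩
    c · γ ∨ c · β  ≤⟨ ∨-least x≤x∨y (≤-trans c·β≤e y≤x∨y) ⟩
    c · γ ∨ e      ∎

  ≤·ρ∨e : ∀ c u → c ≤ c · ρ[ u ] ((e ∨ c) ＼ c) ∨ e
  ≤·ρ∨e c u = ≤·∨e-split (trans (∨-comm _ _) (hps e c e u))
    (≤-trans (·-mono-≤ y≤x∨y λ[e]y≤y) x·x＼y≤y)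

  ≤·λ∨e : ∀ c v → c ≤ c · λ[ v ] ((c ∨ e) ＼ c) ∨ e
  ≤·λ∨e c v = ≤·∨e-split (hps c e v e) (≤-trans (·-mono-≤ x≤x∨y ρ[e]y≤y) x·x＼y≤y)

  ≤·∨e-·ʳ : ∀ {c d γ} → γ ≤ e → c ≤ c · γ ∨ e → c ≤ d ∨ e → c ≤ d · γ ∨ e
  ≤·∨e-·ʳ {c} {d} {γ} γ≤e c≤c·γ∨e c≤d∨e = begin
    c                        ≤⟨ c≤c·γ∨e ⟩
    c · γ ∨ e                ≤⟨ ∨-monoˡ-≤ (·-monoˡ-≤ c≤d∨e) ⟩
    (d ∨ e) · γ ∨ e          ≤⟨ ∨-monoˡ-≤ ·-distribʳ-∨ ⟩
    (d · γ ∨ e · γ) ∨ e      ≤⟨ ∨-least (∨-least x≤x∨y e·γ≤d·γ∨e) y≤x∨y ⟩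
    d · γ ∨ e                ∎
    where
      e·γ≤d·γ∨e : e · γ ≤ d · γ ∨ e
      e·γ≤d·γ∨e = ≤-trans (≤-reflexive (·-identityˡ γ)) (≤-trans γ≤e y≤x∨y)

  ≤·^∨e : ∀ {c t} → t ≤ e → c ≤ c · t ∨ e → ∀ j → c ≤ c · t ^ j ∨ e
  ≤·^∨e {c} _ _ zero = ≤-trans (≤-reflexive (sym (·-identityʳ c))) x≤x∨y
  ≤·^∨e {c} {t} t≤e c≤c·t∨e (suc j) = begin
    c                    ≤⟨ ≤·∨e-·ʳ t≤e c≤c·t∨e (≤·^∨e t≤e c≤c·t∨e j) ⟩
    (c · t ^ j) · t ∨ e  ≡⟨ cong (_∨ e) (·-assoc c _ t) ⟩
    c · (t ^ j · t) ∨ e  ≡⟨ cong (λ w → c · w ∨ e) (^-sucʳ t j) ⟨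
    c · t ^ suc j ∨ e    ∎

  ^·^≤e : ∀ {x y} → x · y ≤ e → ∀ n → x ^ n · y ^ n ≤ e
  ^·^≤e {x} {y} x·y≤e zero = ≤-reflexive (·-identityˡ e)
  ^·^≤e {x} {y} x·y≤e (suc n) = begin
    (x · x ^ n) · y ^ suc n        ≡⟨ cong ((x · x ^ n) ·_) (^-sucʳ y n) ⟩
    (x · x ^ n) · (y ^ n · y)      ≡⟨ ·-assoc x (x ^ n) _ ⟩
    x · (x ^ n · (y ^ n · y))      ≡⟨ cong (x ·_) (·-assoc (x ^ n) (y ^ n) y) ⟨
    x · ((x ^ n · y ^ n) · y)      ≤⟨ ·-monoʳ-≤ (·-monoˡ-≤ (^·^≤e x·y≤e n)) ⟩
    x · (e · y)                    ≡⟨ cong (x ·_) (·-identityˡ y) ⟩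
    x · y                          ≤⟨ x·y≤e ⟩
    e                              ∎

  ·≤^·^∨e : ∀ x y n → x · y ≤ x ^ suc n · y ^ suc n ∨ e
  ·≤^·^∨e x y zero =
    ≤-trans (≤-reflexive (sym (cong₂ _·_ (·-identityʳ x) (·-identityʳ y)))) x≤x∨y
  ·≤^·^∨e x y (suc n) = begin
    x · y                  ≤⟨ ≤·∨e-·ʳ λ≤e (≤·λ∨e (x · y) Y) (·≤^·^∨e x y n) ⟩
    (X · Y) · α ∨ e        ≤⟨ ∨-monoˡ-≤ X·Y·α≤x^2+n·y^2+n ⟩
    x ^ suc (suc n) · y ^ suc (suc n) ∨ e  ∎
    where
      X = x ^ suc n
      Y = y ^ suc n
      α = λ[ Y ] ((x · y ∨ e) ＼ (x · y))
      X·Y·α≤x^2+n·y^2+n : (X · Y) · α ≤ x ^ suc (suc n) · y ^ suc (suc n)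
      X·Y·α≤x^2+n·y^2+n = begin
        (X · Y) · α                       ≡⟨ ·-assoc X Y α ⟩
        X · (Y · α)                       ≤⟨ ·-monoʳ-≤ x·λ[x]y≤y·x ⟩
        X · ((x · y ∨ e) ＼ (x · y) · Y)  ≤⟨ ·-monoʳ-≤ (·-monoˡ-≤ (＼-≤ y≤x∨y)) ⟩
        X · ((x · y) · Y)                 ≡⟨ cong (X ·_) (·-assoc x y Y) ⟩
        X · (x · (y · Y))                 ≡⟨ ·-assoc X x _ ⟨
        (X · x) · (y · Y)                 ≡⟨ cong (_· (y · Y)) (^-sucʳ x (suc n)) ⟨
        x ^ suc (suc n) · y ^ suc (suc n)  ∎

  idempotent⇒ρ·u≤u·y : ∀ {u y} → _·_ IdempotentOn u → ρ[ u ] ((e ∨ u · y) ＼ (u · y)) · u ≤ u · y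
  idempotent⇒ρ·u≤u·y {u} {y} idem = begin
    ρ[ u ] ((e ∨ u · y) ＼ (u · y)) · u  ≤⟨ ρ[x]y·x≤x·y ⟩
    u · (e ∨ u · y) ＼ (u · y)           ≤⟨ ·-monoʳ-≤ (＼-≤ x≤x∨y) ⟩
    u · (u · y)                          ≡⟨ ·-assoc u u y ⟨
    (u · u) · y                          ≡⟨ cong (_· y) idem ⟩
    u · y                                ∎

  module _ (star : IsStar 𝒜) where

    idempotent-·-≤e : ∀ {u p q} → _·_ IdempotentOn u →
                      u · p ≤ e → u · q ≤ e → u · (p · q) ≤ e
    idempotent-·-≤e {u} {p} {q} idem u·p≤e u·q≤e = begin
      u · (p · q)            ≡⟨ cong (_· (p · q)) idem ⟨
      (u · u) · (p · q)      ≡⟨ ·-assoc u u _ ⟩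
      u · (u · (p · q))      ≤⟨ star (u · (p · q)) u [u·p·q]·u≤e ⟩
      e                      ∎
      where
        [u·p·q]·u≤e : (u · (p · q)) · u ≤ e
        [u·p·q]·u≤e = begin
          (u · (p · q)) · u  ≡⟨ cong (_· u) (·-assoc u p q) ⟨
          ((u · p) · q) · u  ≡⟨ ·-assoc (u · p) q u ⟩
          (u · p) · (q · u)  ≤⟨ ·-monoˡ-≤ u·p≤e ⟩
          e · (q · u)        ≡⟨ ·-identityˡ _ ⟩
          q · u              ≤⟨ star u q u·q≤e ⟩
          e                  ∎

    idempotent-^-≤e : ∀ {u y} → _·_ IdempotentOn u → u · y ≤ e → ∀ n → u · y ^ suc n ≤ e
    idempotent-^-≤e {u} {y} idem u·y≤e zero =
      subst (λ w → u · w ≤ e) (sym (·-identityʳ y)) u·y≤e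
    idempotent-^-≤e idem u·y≤e (suc n) =
      idempotent-·-≤e idem u·y≤e (idempotent-^-≤e idem u·y≤e n)

    ^-descent : ∀ {t u y} → t · u ≤ u · y → ∀ i b → u · (y ^ i · b) ≤ e → u · (b · t ^ i) ≤ e
    ^-descent {u = u} _ zero b u·b≤e = begin
      u · (b · e)  ≡⟨ cong (u ·_) (·-identityʳ b) ⟩
      u · b        ≡⟨ cong (u ·_) (·-identityˡ b) ⟨
      u · (e · b)  ≤⟨ u·b≤e ⟩
      e            ∎
    ^-descent {t} {u} {y} t·u≤u·y (suc i) b u·y^suc-i·b≤e = begin
      u · (b · (t · t ^ i))    ≡⟨ cong (u ·_) (·-assoc b t _) ⟨
      u · ((b · t) · t ^ i)    ≤⟨ ^-descent t·u≤u·y i (b · t) u·y^i·b·t≤e ⟩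
      e                        ∎
      where
        t·u·y^i·b≤e : t · (u · (y ^ i · b)) ≤ e
        t·u·y^i·b≤e = begin
          t · (u · (y ^ i · b))    ≡⟨ ·-assoc t u _ ⟨
          (t · u) · (y ^ i · b)    ≤⟨ ·-monoˡ-≤ t·u≤u·y ⟩
          (u · y) · (y ^ i · b)    ≡⟨ ·-assoc u y _ ⟩
          u · (y · (y ^ i · b))    ≡⟨ cong (u ·_) (·-assoc y (y ^ i) b) ⟨
          u · (y ^ suc i · b)      ≤⟨ u·y^suc-i·b≤e ⟩
          e                        ∎
        u·y^i·b·t≤e : u · (y ^ i · (b · t)) ≤ e
        u·y^i·b·t≤e = begin
          u · (y ^ i · (b · t))    ≡⟨ cong (u ·_) (·-assoc (y ^ i) b t) ⟨
          u · ((y ^ i · b) · t)    ≡⟨ ·-assoc u _ t ⟨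
          (u · (y ^ i · b)) · t    ≤⟨ star t _ t·u·y^i·b≤e ⟩
          e                        ∎

    idempotent-root : ∀ {u y} → _·_ IdempotentOn u → ∀ n → u · y ^ suc n ≤ e → u · y ≤ e
    idempotent-root {u} {y} idem n u·y^suc-n≤e = begin
      u · y                ≤⟨ ≤·^∨e ρ≤e (≤·ρ∨e (u · y) u) n ⟩
      (u · y) · t ^ n ∨ e  ≤⟨ ∨-least u·y·t^n≤e ≤-refl ⟩
      e                    ∎
      where
        t = ρ[ u ] ((e ∨ u · y) ＼ (u · y))
        u·y^n·y≤e : u · (y ^ n · y) ≤ e
        u·y^n·y≤e = subst (λ w → u · w ≤ e) (^-sucʳ y n) u·y^suc-n≤e
        u·y·t^n≤e : (u · y) · t ^ n ≤ e
        u·y·t^n≤e = subst (_≤ e) (sym (·-assoc u y _))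
          (^-descent (idempotent⇒ρ·u≤u·y idem) n y u·y^n·y≤e)

    ·≤e⇔idempotent-^·≤e : ∀ {x n} → _·_ IdempotentOn (x ^ suc n) →
                          ∀ z → x · z ≤ e ⇔ x ^ suc n · z ≤ e
    ·≤e⇔idempotent-^·≤e {x} {n} idem z = mk⇔
      (λ x·z≤e → idempotent-root idem n (^·^≤e x·z≤e (suc n)))
      (λ u·z≤e → begin
        x · z                          ≤⟨ ·≤^·^∨e x z n ⟩
        x ^ suc n · z ^ suc n ∨ e      ≤⟨ ∨-least (idempotent-^-≤e idem u·z≤e n) ≤-refl ⟩
        e                              ∎)

    finite⇒omega : IsFinite 𝒜 → IsOmega 𝒜
    finite⇒omega (_ , A↔Fin) x with m , idem ← finite⇒idempotent-power A↔Fin x =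
      ≤-antisym (＼-≤-＼ (λ z → from (x·x-annihilates z) ∘ to (x-annihilates z)))
                (＼-≤-＼ (λ z → from (x-annihilates z) ∘ to (x·x-annihilates z)))
      where
        open Equivalence
        u = x ^ suc m
        x·x-shares-power : (x · x) ^ suc m ≡ u
        x·x-shares-power = trans (^-square x (suc m)) idem
        x-annihilates : ∀ z → x · z ≤ e ⇔ u · z ≤ e
        x-annihilates = ·≤e⇔idempotent-^·≤e {n = m} idem
        x·x-idempotent : _·_ IdempotentOn ((x · x) ^ suc m)
        x·x-idempotent = subst (_·_ IdempotentOn_) (sym x·x-shares-power) idem
        x·x-annihilates : ∀ z → (x · x) · z ≤ e ⇔ u · z ≤ e
        x·x-annihilates z = subst (λ w → (x · x) · z ≤ e ⇔ w · z ≤ e) x·x-shares-power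
          (·≤e⇔idempotent-^·≤e {n = m} x·x-idempotent z)

lemma2p6 : ∀ {a : Level} →
    ((𝒜 : HpsUL a) → IsFinite 𝒜 → IsStar 𝒜 → IsChain 𝒜 → IsStar 𝒜 × IsOmega 𝒜 × IsChain 𝒜)
    × ((𝒜 : HpsUL a) → IsFinite 𝒜 → IsStar 𝒜 → IsStar 𝒜 × IsOmega 𝒜)
lemma2p6 = (λ 𝒜 finite star chain → star , finite⇒omega 𝒜 star finite , chain)
         , (λ 𝒜 finite star → star , finite⇒omega 𝒜 star finite)
  where open HpsULProperties using (finite⇒omega)
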